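{- Suppose a resolvable Steiner system $S(n,k-1,2)$ exists, and let $H_1,\ldots,H_t$ be graphs each having fewer than $k$ vertices, where $t\le (n-1)/(k-2)$. Then $f(H_1,\ldots,H_t)\le n$.
   Context: All graphs are finite and simple. A graph $G$ is $(H_1,\ldots,H_t)$-full if every vertex of $G$ belongs to an induced subgraph of $G$ isomorphic to $H_i$, for each $i=1,\ldots,t$; $f(H_1,\ldots,H_t)$ is the minimum number of vertices of such a graph. A Steiner system $S(n,k,2)$ is a $k$-uniform hypergraph on $n$ vertices in which every pair of vertices lies in exactly one edge. It is resolvable if its edge set can be partitioned into perfect matchings (sets of pairwise disjoint edges whose union is the whole vertex set). -}

module Defs where

open import Data.Nat using (ℕ; _≤_; _<_)
open import Data.Bool using (Bool; false)
open import Data.Fin using (Fin)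
open import Data.Fin.Subset using (Subset; _∈_; ∣_∣)
open import Data.Product using (Σ; ∃; ∃!; _×_)
open import Function.Definitions using (Injective)
open import Relation.Binary.PropositionalEquality using (_≡_; _≢_)

record Graph : Set where
  field
    size   : ℕ
    adj    : Fin size → Fin size → Bool
    sym    : ∀ u v → adj u v ≡ adj v u
    irrefl : ∀ v → adj v v ≡ false
open Graph public

InducedEmbedding : Graph → Graph → Set
InducedEmbedding H G =
  Σ (Fin (size H) → Fin (size G)) λ φ →
    Injective _≡_ _≡_ φ × (∀ a b → adj G (φ a) (φ b) ≡ adj H a b)

InCopyOf : (G H : Graph) → Fin (size G) → Set
InCopyOf G H v =
  Σ (InducedEmbedding H G) λ e → ∃ λ a → Σ.proj₁ e a ≡ v

Full : (G : Graph) {t : ℕ} → (Fin t → Graph) → Set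
Full G H = ∀ i (v : Fin (size G)) → InCopyOf G (H i) v

-- A Steiner system S(n,r,2) given by its b (distinct) blocks, together
-- with a resolution: colouring of blocks into classes such that each class
-- is a perfect matching (every vertex lies in exactly one block of the class).
record ResolvableSteiner (n r : ℕ) : Set where
  field
    b        : ℕ
    block    : Fin b → Subset n
    distinct : Injective _≡_ _≡_ block
    uniform  : ∀ i → ∣ block i ∣ ≡ r
    pairs    : ∀ (x y : Fin n) → x ≢ y →
               ∃! _≡_ λ i → x ∈ block i × y ∈ block i
    cls      : Fin b → ℕ
    matching : ∀ (i : Fin b) (x : Fin n) →
               ∃! _≡_ λ j → cls j ≡ cls i × x ∈ block j

{-# OPTIONS --safe #-}
module Submission where

open import Defs
open import Data.Nat using (ℕ; _≤_; _<_; _*_; _+_; _∸_)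
open import Data.Fin using (Fin)
open import Data.Product using (Σ; _×_)

open import Data.Bool using (T; true; false)
open import Data.Empty using (⊥-elim)
open import Data.Fin using (zero; suc; toℕ; fromℕ<; inject≤)
open import Data.Fin.Properties using (any?; suc-injective; ¬∀⟶∃¬; toℕ-injective; toℕ-fromℕ<; toℕ-inject≤; toℕ<n)
  renaming (_≟_ to _≟ᶠ_)
open import Data.Fin.Subset using (Subset; _∈_; _∉_; _⊆_; ∣_∣; _∪_; _∩_; ⁅_⁆; ⊤)
open import Data.Fin.Subset.Properties
  using (_∈?_; ∣⊤∣≡n; p⊆q⇒∣p∣≤∣q∣; x∈p⇒∣p-x∣<∣p∣; x∈⁅x⁆; x∈p∩q⁺; x∈p∪q⁺; ∣⁅x⁆∣≡1)
open import Data.Nat using (zero; suc; z≤n; s≤s; _<?_) renaming (_≟_ to _≟ⁿ_)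
import Data.Nat.Properties as ℕ
open import Data.Product using (_,_; ∃; ∃₂)
open import Data.Sum using (inj₁; inj₂)
open import Data.Vec using ([]; _∷_; here; there)
open import Data.Vec.Functional using (head; tail) renaming (_∷_ to _◂_)
open import Function using (id; _∘_; mk⇔)
open import Function.Definitions using (Injective)
open import Relation.Binary using (Decidable; Symmetric)
open import Relation.Binary.PropositionalEquality as ≡ using (_≡_; _≢_; refl; cong; cong₂; subst)
open import Relation.Nullary using (¬_; yes; no; does)
open import Relation.Nullary.Decidable using (dec-false; does-⇔; _×-dec_; T?)

-- Fix a point x. Each block through x contains k − 2 further points and every other point
-- lies in exactly one of them, so there are (n − 1)/(k − 2) ≥ t such blocks; being pairwise
-- intersecting they lie in pairwise distinct parallel classes. Give the i-th of these classes
-- to H_i: on every block of that class place a copy of H_i, one vertex blown up into twins so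
-- as to fill the k − 1 points. As every pair of points lies in a unique block, these local
-- graphs glue to a graph on the n points that induces each of them, and as a parallel class
-- covers every point, each point lies in an induced copy of every H_i.

∣p∪q∣+∣p∩q∣≡∣p∣+∣q∣ : ∀ {n} (p q : Subset n) → ∣ p ∪ q ∣ + ∣ p ∩ q ∣ ≡ ∣ p ∣ + ∣ q ∣
∣p∪q∣+∣p∩q∣≡∣p∣+∣q∣ []          []          = refl
∣p∪q∣+∣p∩q∣≡∣p∣+∣q∣ (true  ∷ p) (true  ∷ q) =
  cong suc (≡.trans (ℕ.+-suc _ _) (≡.trans (cong suc (∣p∪q∣+∣p∩q∣≡∣p∣+∣q∣ p q)) (≡.sym (ℕ.+-suc _ _))))
∣p∪q∣+∣p∩q∣≡∣p∣+∣q∣ (true  ∷ p) (false ∷ q) = cong suc (∣p∪q∣+∣p∩q∣≡∣p∣+∣q∣ p q)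
∣p∪q∣+∣p∩q∣≡∣p∣+∣q∣ (false ∷ p) (true  ∷ q) = ≡.trans (cong suc (∣p∪q∣+∣p∩q∣≡∣p∣+∣q∣ p q)) (≡.sym (ℕ.+-suc _ _))
∣p∪q∣+∣p∩q∣≡∣p∣+∣q∣ (false ∷ p) (false ∷ q) = ∣p∪q∣+∣p∩q∣≡∣p∣+∣q∣ p q

∣p∣<n⇒∃∉ : ∀ {n} (p : Subset n) → ∣ p ∣ < n → ∃ λ y → y ∉ p
∣p∣<n⇒∃∉ {n} p ∣p∣<n = ¬∀⟶∃¬ n (_∈ p) (_∈? p) λ all∈ →
  ℕ.<⇒≱ ∣p∣<n (subst (_≤ ∣ p ∣) (∣⊤∣≡n n) (p⊆q⇒∣p∣≤∣q∣ {p = ⊤} (λ {x} _ → all∈ x)))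

∷-injective : ∀ {A : Set} {m} {a : A} {g : Fin m → A} →
              (∀ l → g l ≢ a) → Injective _≡_ _≡_ g → Injective _≡_ _≡_ (a ◂ g)
∷-injective a∉g g-inj {zero}  {zero}  _  = refl
∷-injective a∉g g-inj {zero}  {suc l} eq = ⊥-elim (a∉g l (≡.sym eq))
∷-injective a∉g g-inj {suc l} {zero}  eq = ⊥-elim (a∉g l eq)
∷-injective a∉g g-inj {suc l} {suc l′} eq = cong suc (g-inj eq)

record Enumeration {n} (p : Subset n) (m : ℕ) : Set where
  field
    elem           : Fin m → Fin n
    elem-injective : Injective _≡_ _≡_ elem
    elem∈          : ∀ a → elem a ∈ p
    elem-onto      : ∀ {x} → x ∈ p → ∃ λ a → elem a ≡ x

enumerate : ∀ {n} (p : Subset n) → Enumeration p ∣ p ∣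
enumerate [] = record { elem = λ () ; elem-injective = λ {} ; elem∈ = λ () ; elem-onto = λ () }
enumerate (false ∷ p) = record
  { elem           = suc ∘ elem
  ; elem-injective = elem-injective ∘ suc-injective
  ; elem∈          = there ∘ elem∈
  ; elem-onto      = λ { (there x∈p) → let a , eq = elem-onto x∈p in a , cong suc eq }
  }
  where open Enumeration (enumerate p)
enumerate (true ∷ p) = record
  { elem           = zero ◂ suc ∘ elem
  ; elem-injective = ∷-injective (λ _ ()) (elem-injective ∘ suc-injective)
  ; elem∈          = λ { zero → here ; (suc a) → there (elem∈ a) }
  ; elem-onto      = λ { {zero} _ → zero , refl
                       ; {suc x} (there x∈p) → let a , eq = elem-onto x∈p in suc a , cong suc eq }
  }
  where open Enumeration (enumerate p)

graphOf : ∀ {m} (R : Fin m → Fin m → Set) → Decidable R → Symmetric R → (∀ x → ¬ R x x) → Graph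
graphOf {m} R R? R-sym R-irrefl = record
  { size   = m
  ; adj    = λ x y → does (R? x y)
  ; sym    = λ x y → does-⇔ (mk⇔ R-sym R-sym) (R? x y) (R? y x)
  ; irrefl = λ x → dec-false (R? x x) (R-irrefl x)
  }

InCopyOf-map : ∀ H G K {v} (e : InducedEmbedding G K) →
               InCopyOf G H v → InCopyOf K H (Σ.proj₁ e v)
InCopyOf-map H G K (ψ , ψ-inj , ψ-adj) ((φ , φ-inj , φ-adj) , a , φa≡v) =
  (ψ ∘ φ , φ-inj ∘ ψ-inj , λ a b → ≡.trans (ψ-adj (φ a) (φ b)) (φ-adj a b)) , a , cong ψ φa≡v

module Retraction {N s : ℕ} (1≤s : 1 ≤ s) (s≤N : s ≤ N) where

  retract : Fin N → Fin s
  retract p with toℕ p <? s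
  ... | yes p<s = fromℕ< p<s
  ... | no  _   = fromℕ< 1≤s

  retract-inject≤ : ∀ a → retract (inject≤ a s≤N) ≡ a
  retract-inject≤ a with toℕ (inject≤ a s≤N) <? s
  ... | yes a<s = toℕ-injective (≡.trans (toℕ-fromℕ< a<s) (toℕ-inject≤ a s≤N))
  ... | no  a≮s = ⊥-elim (a≮s (subst (_< s) (≡.sym (toℕ-inject≤ a s≤N)) (toℕ<n a)))

  section : Fin N → Fin s → Fin N
  section p a with a ≟ᶠ retract p
  ... | yes _ = p
  ... | no  _ = inject≤ a s≤N

  retract∘section : ∀ p a → retract (section p a) ≡ a
  retract∘section p a with a ≟ᶠ retract p
  ... | yes a≡rp = ≡.sym a≡rp
  ... | no  _    = retract-inject≤ a

  section-hits : ∀ p → section p (retract p) ≡ p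
  section-hits p with retract p ≟ᶠ retract p
  ... | yes _   = refl
  ... | no  rp≢rp = ⊥-elim (rp≢rp refl)

module _ (H : Graph) {m : ℕ} (1≤∣H∣ : 1 ≤ size H) (∣H∣≤m : size H ≤ m) where
  open Retraction 1≤∣H∣ ∣H∣≤m

  -- H with vertex 0 replaced by m ∸ size H + 1 pairwise non-adjacent twins.
  blowUp : Graph
  blowUp = record
    { size   = m
    ; adj    = λ p q → adj H (retract p) (retract q)
    ; sym    = λ p q → sym H (retract p) (retract q)
    ; irrefl = λ p → irrefl H (retract p)
    }

  blowUp-full : ∀ p → InCopyOf blowUp H p
  blowUp-full p = (section p , section-injective , section-adj) , retract p , section-hits p
    where
    section-injective : Injective _≡_ _≡_ (section p)
    section-injective {a} {b} eq =
      ≡.trans (≡.sym (retract∘section p a)) (≡.trans (cong retract eq) (retract∘section p b))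
    section-adj : ∀ a b → adj blowUp (section p a) (section p b) ≡ adj H a b
    section-adj a b = cong₂ (adj H) (retract∘section p a) (retract∘section p b)

module Gluing {n b : ℕ} (block : Fin b → Subset n)
  (linear : ∀ {x y j j′} → x ≢ y → x ∈ block j → y ∈ block j → x ∈ block j′ → y ∈ block j′ → j ≡ j′)
  (piece : Fin b → Graph)
  (place : ∀ j → Fin (size (piece j)) → Fin n)
  (place-injective : ∀ j → Injective _≡_ _≡_ (place j))
  (place∈ : ∀ j p → place j p ∈ block j)
  where

  GluedEdge : Fin n → Fin n → Set
  GluedEdge x y = ∃ λ j → ∃₂ λ p q → place j p ≡ x × place j q ≡ y × T (adj (piece j) p q)

  GluedEdge? : Decidable GluedEdge
  GluedEdge? x y = any? λ j → any? λ p → any? λ q →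
    (place j p ≟ᶠ x) ×-dec (place j q ≟ᶠ y) ×-dec T? (adj (piece j) p q)

  GluedEdge-sym : Symmetric GluedEdge
  GluedEdge-sym (j , p , q , px , qy , pq) = j , q , p , qy , px , subst T (sym (piece j) p q) pq

  GluedEdge-irrefl : ∀ x → ¬ GluedEdge x x
  GluedEdge-irrefl x (j , p , q , refl , qx , pq) with place-injective j qx
  ... | refl = subst T (irrefl (piece j) p) pq

  glued : Graph
  glued = graphOf GluedEdge GluedEdge? GluedEdge-sym GluedEdge-irrefl

  place-induced : ∀ j → InducedEmbedding (piece j) glued
  place-induced j = place j , place-injective j , λ p q →
    does-⇔ (mk⇔ (edge-in-piece p q) λ pq → j , p , q , refl , refl , pq) (GluedEdge? _ _) (T? _)
    where
    edge-in-piece : ∀ p q → GluedEdge (place j p) (place j q) → T (adj (piece j) p q)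
    edge-in-piece p q e@(j′ , p′ , q′ , p′≡p , q′≡q , pq)
      with linear (λ p≡q → GluedEdge-irrefl _ (subst (GluedEdge _) (≡.sym p≡q) e))
                  (place∈ j p) (place∈ j q)
                  (subst (_∈ block j′) p′≡p (place∈ j′ p′))
                  (subst (_∈ block j′) q′≡q (place∈ j′ q′))
    ... | refl with place-injective j p′≡p | place-injective j q′≡q
    ... | refl | refl = pq

module _ {n r : ℕ} (S : ResolvableSteiner n r) where
  open ResolvableSteiner S

  steiner-linear : ∀ {x y j j′} → x ≢ y →
                   x ∈ block j → y ∈ block j → x ∈ block j′ → y ∈ block j′ → j ≡ j′
  steiner-linear x≢y x∈j y∈j x∈j′ y∈j′ =
    let _ , _ , unique = pairs _ _ x≢y
    in ≡.trans (≡.sym (unique (x∈j , y∈j))) (unique (x∈j′ , y∈j′))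

  cls-injective-at : ∀ {x j j′} → x ∈ block j → x ∈ block j′ → cls j ≡ cls j′ → j ≡ j′
  cls-injective-at {x} {j} x∈j x∈j′ same =
    let _ , _ , unique = matching j x
    in ≡.trans (≡.sym (unique (refl , x∈j))) (unique (≡.sym same , x∈j′))

module _ {n K : ℕ} (S : ResolvableSteiner n (suc K)) (x : Fin n) where
  open ResolvableSteiner S

  Through : ∀ {m} → (Fin m → Fin b) → Set
  Through g = ∀ l → x ∈ block (g l)

  covered : ∀ {m} → (Fin m → Fin b) → Subset n
  covered {zero}  g = ⁅ x ⁆
  covered {suc m} g = block (head g) ∪ covered (tail g)

  x∈covered : ∀ {m} (g : Fin m → Fin b) → Through g → x ∈ covered g
  x∈covered {zero}  g through = x∈⁅x⁆ x
  x∈covered {suc m} g through = x∈p∪q⁺ (inj₁ (through zero))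

  block⊆covered : ∀ {m} (g : Fin m → Fin b) l → block (g l) ⊆ covered g
  block⊆covered g zero    = x∈p∪q⁺ ∘ inj₁
  block⊆covered g (suc l) = x∈p∪q⁺ ∘ inj₂ ∘ block⊆covered (tail g) l

  ∣covered∣≤ : ∀ {m} (g : Fin m → Fin b) → Through g → ∣ covered g ∣ ≤ suc (m * K)
  ∣covered∣≤ {zero}  g through = ℕ.≤-reflexive (∣⁅x⁆∣≡1 x)
  ∣covered∣≤ {suc m} g through = ℕ.+-cancelʳ-≤ 1 _ _ (begin
    ∣ B ∪ C ∣ + 1          ≤⟨ ℕ.+-monoʳ-≤ ∣ B ∪ C ∣ 0<∣B∩C∣ ⟩
    ∣ B ∪ C ∣ + ∣ B ∩ C ∣  ≡⟨ ∣p∪q∣+∣p∩q∣≡∣p∣+∣q∣ B C ⟩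
    ∣ B ∣ + ∣ C ∣          ≡⟨ cong (_+ ∣ C ∣) (uniform (head g)) ⟩
    suc K + ∣ C ∣          ≤⟨ ℕ.+-monoʳ-≤ (suc K) (∣covered∣≤ (tail g) (through ∘ suc)) ⟩
    suc K + suc (m * K)    ≡⟨ ℕ.+-suc (suc K) (m * K) ⟩
    suc (suc (K + m * K))  ≡⟨ ℕ.+-comm 1 _ ⟩
    suc (K + m * K) + 1    ∎)
    where
    open ℕ.≤-Reasoning
    B = block (head g)
    C = covered (tail g)
    0<∣B∩C∣ : 0 < ∣ B ∩ C ∣
    0<∣B∩C∣ = ℕ.≤-<-trans z≤n
      (x∈p⇒∣p-x∣<∣p∣ (x∈p∩q⁺ (through zero , x∈covered (tail g) (through ∘ suc))))

  newBlockThrough : ∀ {m} (g : Fin m → Fin b) → Through g → ∀ {y} → y ∉ covered g →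
                    ∃ λ j → x ∈ block j × (∀ l → g l ≢ j)
  newBlockThrough g through {y} y∉covered =
    let j , (x∈j , y∈j) , _ = pairs x y x≢y
    in j , x∈j , λ l gl≡j → y∉covered (block⊆covered g l (subst (λ j → y ∈ block j) (≡.sym gl≡j) y∈j))
    where
    x≢y : x ≢ y
    x≢y x≡y = y∉covered (subst (_∈ covered g) x≡y (x∈covered g through))

  distinctBlocksThrough : 1 ≤ K → ∀ m → m * K < n →
                          Σ (Fin m → Fin b) λ g → Injective _≡_ _≡_ g × Through g
  distinctBlocksThrough _ zero _ = (λ ()) , (λ {}) , (λ ())
  distinctBlocksThrough 1≤K (suc m) [1+m]K<n
    with distinctBlocksThrough 1≤K m (ℕ.≤-<-trans (ℕ.m≤n+m (m * K) K) [1+m]K<n)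
  ... | g , g-injective , through
    with ∣p∣<n⇒∃∉ (covered g)
           (ℕ.≤-<-trans (ℕ.≤-trans (∣covered∣≤ g through) (ℕ.+-monoˡ-≤ (m * K) 1≤K)) [1+m]K<n)
  ... | y , y∉covered
    with newBlockThrough g through y∉covered
  ... | j , x∈j , j∉g = j ◂ g , ∷-injective j∉g g-injective , λ { zero → x∈j ; (suc l) → through l }

distinctClasses : ∀ {n K t} (S : ResolvableSteiner n (suc K)) → 1 ≤ K → t * K < n →
                  Σ (Fin t → Fin (ResolvableSteiner.b S)) λ g →
                    Injective _≡_ _≡_ (λ i → ResolvableSteiner.cls S (g i))
distinctClasses {t = t} S 1≤K tK<n
  with distinctBlocksThrough S (fromℕ< (ℕ.≤-<-trans z≤n tK<n)) 1≤K t tK<n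
... | g , g-injective , through = g , λ {i} {i′} → g-injective ∘ cls-injective-at S (through i) (through i′)

module _ {n K t : ℕ} (S : ResolvableSteiner n (suc K))
  (H : Fin t → Graph) (1≤∣H∣ : ∀ i → 1 ≤ size (H i)) (∣H∣≤ : ∀ i → size (H i) ≤ suc K)
  (chosen : Fin t → Fin (ResolvableSteiner.b S))
  (chosen-classes-distinct : Injective _≡_ _≡_ (λ i → ResolvableSteiner.cls S (chosen i)))
  where
  open ResolvableSteiner S

  private
    blown : Fin t → Graph
    blown i = blowUp (H i) (1≤∣H∣ i) (∣H∣≤ i)

    PieceEdge : Fin b → Fin (suc K) → Fin (suc K) → Set
    PieceEdge j p q = ∃ λ i → cls j ≡ cls (chosen i) × T (adj (blown i) p q)

    PieceEdge? : ∀ j → Decidable (PieceEdge j)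
    PieceEdge? j p q = any? λ i → (cls j ≟ⁿ cls (chosen i)) ×-dec T? (adj (blown i) p q)

    piece : Fin b → Graph
    piece j = graphOf (PieceEdge j) (PieceEdge? j)
      (λ (i , same , pq) → i , same , subst T (sym (blown i) _ _) pq)
      (λ p (i , _ , pp) → subst T (irrefl (blown i) p) pp)

    blown-induced : ∀ {i j} → cls j ≡ cls (chosen i) → InducedEmbedding (blown i) (piece j)
    blown-induced {i} {j} same = id , id , λ p q →
      does-⇔ (mk⇔ (edge-of-blown p q) (λ pq → i , same , pq)) (PieceEdge? j p q) (T? _)
      where
      edge-of-blown : ∀ p q → PieceEdge j p q → T (adj (blown i) p q)
      edge-of-blown p q (i′ , same′ , pq) with chosen-classes-distinct (≡.trans (≡.sym same) same′)
      ... | refl = pq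

    enum : ∀ j → Enumeration (block j) (suc K)
    enum j = subst (Enumeration (block j)) (uniform j) (enumerate (block j))

    open Gluing block (steiner-linear S) piece
      (Enumeration.elem ∘ enum) (Enumeration.elem-injective ∘ enum) (Enumeration.elem∈ ∘ enum)

  resolvable⇒full : Σ Graph λ G → size G ≡ n × Full G H
  resolvable⇒full = glued , refl , full
    where
    full : Full glued H
    full i v with matching (chosen i) v
    ... | j , (same , v∈j) , _ with Enumeration.elem-onto (enum j) v∈j
    ... | p , refl = InCopyOf-map (H i) (piece j) glued (place-induced j)
                       (InCopyOf-map (H i) (blown i) (piece j) (blown-induced same)
                         (blowUp-full (H i) (1≤∣H∣ i) (∣H∣≤ i) p))

theorem2p2 : (n k t : ℕ) → 3 ≤ k → ResolvableSteiner n (k ∸ 1) →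
    (H : Fin t → Graph) → (∀ i → 1 ≤ size (H i) × size (H i) < k) →
    t * (k ∸ 2) + 1 ≤ n →
    Σ Graph λ G → 1 ≤ size G × size G ≤ n × Full G H
theorem2p2 n (suc (suc (suc K))) t (s≤s (s≤s (s≤s _))) S H H-sizes tK+1≤n =
  let tK<n = subst (_≤ n) (ℕ.+-comm _ 1) tK+1≤n
      chosen , classes-distinct = distinctClasses S (s≤s z≤n) tK<n
      G , ∣G∣≡n , full = resolvable⇒full S H (Σ.proj₁ ∘ H-sizes) (ℕ.≤-pred ∘ Σ.proj₂ ∘ H-sizes)
                                          chosen classes-distinct
  in G , subst (1 ≤_) (≡.sym ∣G∣≡n) (ℕ.≤-<-trans z≤n tK<n) , ℕ.≤-reflexive ∣G∣≡n , full
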